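{- For all integers $n\ge 0$, $m\ge 0$ and $p\ge 1$, $$P(n,m,p) = \sum_{k=0}^{n-m} a_k^{(m,p-1)}\, P(n-k,m),$$ where the sum is empty (equal to $0$) if $n<m$.
   Context: For integers $m\ge0$ and $p\ge 0$, $a_k^{(m,p)}$ denotes the coefficient of $q^k$ in the polynomial $\prod_{j=1}^m (1-q^{p+j})$. $P(n,m)$ is the number of integer partitions of $n$ into exactly $m$ parts ($P(0,0)=1$), and $P(n,m,p)$ is the number of integer partitions of $n$ into exactly $m$ parts, each part at most $p$ ($P(0,0,p)=1$). -}

module Defs where

open import Data.Nat using (ℕ; zero; suc; _+_; _∸_; _≤?_; _≟_)
open import Data.Integer using (ℤ; +_; -_) renaming (_+_ to _+ℤ_; _*_ to _*ℤ_)
open import Data.List using (List; []; _∷_; length; map; concatMap; filter; upTo; sum; foldr)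
open import Data.List.Relation.Unary.All using (All)
open import Data.List.Relation.Unary.All.Properties using ()
open import Relation.Nullary.Decidable using (Dec; _×-dec_)
open import Data.List.Relation.Unary.All using (all?)
open import Data.Nat using (_≤_)
open import Relation.Binary.PropositionalEquality using (_≡_)

-- A partition of n is a weakly decreasing list of positive integers
-- summing to n.  'partsLe b n' lists all partitions of n whose parts are
-- all ≤ b (each exactly once, as weakly decreasing lists), generated by
-- choosing the largest part first.  Fuel = n suffices since each part is ≥ 1.

partsLeF : ℕ → ℕ → ℕ → List (List ℕ)
partsLeF fuel     b zero    = [] ∷ []
partsLeF zero     b (suc n) = []
partsLeF (suc f)  b (suc n) =
  concatMap (λ j → map (λ rest → suc j ∷ rest) (partsLeF f (suc j) (suc n ∸ suc j)))
            (filter (λ j → suc j ≤? b) (filter (λ j → suc j ≤? suc n) (upTo (suc n))))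

partitions : ℕ → List (List ℕ)
partitions n = partsLeF n n n

P : ℕ → ℕ → ℕ
P n m = length (filter (λ λs → length λs ≟ m) (partitions n))

P₃ : ℕ → ℕ → ℕ → ℕ
P₃ n m p = length (filter (λ λs → (length λs ≟ m) ×-dec all? (λ x → x ≤? p) λs) (partitions n))

-- Polynomials in q with integer coefficients as coefficient lists
-- (index k = coefficient of q^k).

Poly : Set
Poly = List ℤ

addP : Poly → Poly → Poly
addP []       ys       = ys
addP xs       []       = xs
addP (x ∷ xs) (y ∷ ys) = (x +ℤ y) ∷ addP xs ys

scaleP : ℤ → Poly → Poly
scaleP c = map (c *ℤ_)

mulP : Poly → Poly → Poly
mulP []       ys = []
mulP (x ∷ xs) ys = addP (scaleP x ys) (+ 0 ∷ mulP xs ys)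

monoP : ℕ → Poly
monoP zero    = + 1 ∷ []
monoP (suc e) = + 0 ∷ monoP e

oneMinusQ^ : ℕ → Poly
oneMinusQ^ e = addP (+ 1 ∷ []) (scaleP (- (+ 1)) (monoP e))

prodPoly : ℕ → ℕ → Poly
prodPoly zero    p = + 1 ∷ []
prodPoly (suc m) p = mulP (prodPoly m p) (oneMinusQ^ (p + suc m))

coeff : Poly → ℕ → ℤ
coeff []       k       = + 0
coeff (x ∷ xs) zero    = x
coeff (x ∷ xs) (suc k) = coeff xs k

a : ℕ → ℕ → ℕ → ℤ
a k m p = coeff (prodPoly m p) k

sumBelow : ℕ → (ℕ → ℤ) → ℤ
sumBelow zero    f = + 0
sumBelow (suc N) f = sumBelow N f +ℤ f N

{-# OPTIONS --safe #-}
-- Let Q(b, m) and G(m) be the generating series of partitions into exactly m parts, with all parts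
-- at most b and unrestricted respectively, and A(m, c) = ∏_{j=1}^{m} (1 - x^{c+j}).  Removing a
-- largest part gives Q(b+1, m+1) = Q(b, m+1) + x^{b+1} Q(b+1, m).  Iterating this recurrence gives
-- the smallest-part recurrence Q(b+1, m+1) = x Q(b+1, m) + x^{m+1} Q(b, m+1), and since Q(b, m)
-- agrees with G(m) up to degree b, (1 - x^{m+1}) G(m+1) = x G(m).  Together with
-- A(m+1, c+1) - A(m+1, c) = x^{c+1} (1 - x^{m+1}) A(m, c+1) this shows that A(m, c) G(m) satisfies
-- the largest-part recurrence and initial values of Q(c+1, m), so Q(c+1, m) = A(m, c) G(m).
-- Comparing coefficients of x^n gives the theorem; the terms with n - k < m vanish since
-- P(n - k, m) = 0 there.
module Submission where

open import Defs
open import Data.Nat using (ℕ; zero; suc; _+_; _∸_; _≤_; _<_; _⊓_; _≤ᵇ_; _≤?_; _≟_; z≤n; s≤s)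
open import Data.Nat.Properties
open import Data.Integer using (ℤ; +_; _*_; -_) renaming (_+_ to _+ℤ_; _-_ to _-ℤ_)
import Data.Integer.Properties as ℤ
open import Data.Integer.Tactic.RingSolver using (solve-∀)
open import Data.Bool using (Bool; true; false; _∧_; if_then_else_)
open import Data.Bool.Properties using (∧-zeroʳ; if-eta; if-∧)
open import Data.List using (List; []; _∷_; _++_; length; map; filter; concatMap; upTo; applyUpTo)
open import Data.List.Properties using (filter-all; map-upTo)
open import Data.List.Relation.Unary.All using (all?)
open import Data.List.Relation.Unary.All.Properties using (applyUpTo⁺₁)
open import Data.Nat.ListAction using (sum)
open import Data.Sum using (inj₁; inj₂)
open import Function using (_∘_)
open import Relation.Nullary using (Dec; does; _×-dec_)
open import Relation.Nullary.Reflects using (ofʸ)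
open import Relation.Binary.PropositionalEquality
open ≡-Reasoning

count : {A : Set} → (A → Bool) → List A → ℕ
count g []       = 0
count g (x ∷ xs) = if g x then suc (count g xs) else count g xs

length-filter≡count : ∀ {A : Set} {ℓ} {P : A → Set ℓ} (P? : ∀ x → Dec (P x)) xs →
                      length (filter P? xs) ≡ count (does ∘ P?) xs
length-filter≡count P? []       = refl
length-filter≡count P? (x ∷ xs) with does (P? x)
... | true  = cong suc (length-filter≡count P? xs)
... | false = length-filter≡count P? xs

count-++ : ∀ {A : Set} (g : A → Bool) xs ys → count g (xs ++ ys) ≡ count g xs + count g ys
count-++ g []       ys = refl
count-++ g (x ∷ xs) ys with g x
... | true  = cong suc (count-++ g xs ys)
... | false = count-++ g xs ys

count-concatMap : ∀ {A B : Set} (g : B → Bool) (G : A → List B) xs →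
                  count g (concatMap G xs) ≡ sum (map (count g ∘ G) xs)
count-concatMap g G []       = refl
count-concatMap g G (x ∷ xs) =
  trans (count-++ g (G x) (concatMap G xs)) (cong (_+_ (count g (G x))) (count-concatMap g G xs))

count-map : ∀ {A B : Set} (g : B → Bool) (h : A → B) xs → count g (map h xs) ≡ count (g ∘ h) xs
count-map g h []       = refl
count-map g h (x ∷ xs) with g (h x)
... | true  = cong suc (count-map g h xs)
... | false = count-map g h xs

count-cong : ∀ {A : Set} {g h : A → Bool} → (∀ x → g x ≡ h x) → ∀ xs → count g xs ≡ count h xs
count-cong eq []       = refl
count-cong eq (x ∷ xs) rewrite eq x | count-cong eq xs = refl

count-false : ∀ {A : Set} (xs : List A) → count (λ _ → false) xs ≡ 0
count-false []       = refl
count-false (x ∷ xs) = count-false xs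

count-∧-guard : ∀ {A : Set} (g h : A → Bool) c xs →
                count (λ x → g x ∧ (c ∧ h x)) xs ≡ (if c then count (λ x → g x ∧ h x) xs else 0)
count-∧-guard g h true  xs = refl
count-∧-guard g h false xs = trans (count-cong (λ x → ∧-zeroʳ (g x)) xs) (count-false xs)

sum-map-filter : ∀ {A : Set} {ℓ} {P : A → Set ℓ} (P? : ∀ x → Dec (P x)) (F : A → ℕ) xs →
                 sum (map F (filter P? xs)) ≡ sum (map (λ x → if does (P? x) then F x else 0) xs)
sum-map-filter P? F []       = refl
sum-map-filter P? F (x ∷ xs) with does (P? x)
... | true  = cong (_+_ (F x)) (sum-map-filter P? F xs)
... | false = sum-map-filter P? F xs

sum-applyUpTo-cong : ∀ N {F G : ℕ → ℕ} → (∀ j → F j ≡ G j) →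
                     sum (applyUpTo F N) ≡ sum (applyUpTo G N)
sum-applyUpTo-cong zero    eq = refl
sum-applyUpTo-cong (suc N) eq = cong₂ _+_ (eq 0) (sum-applyUpTo-cong N (eq ∘ suc))

sum-applyUpTo-zero : ∀ N {F : ℕ → ℕ} → (∀ j → F j ≡ 0) → sum (applyUpTo F N) ≡ 0
sum-applyUpTo-zero zero    eq = refl
sum-applyUpTo-zero (suc N) eq = cong₂ _+_ (eq 0) (sum-applyUpTo-zero N (eq ∘ suc))

sum-applyUpTo-split : ∀ N b (h : ℕ → ℕ) →
  sum (applyUpTo (λ j → if suc j ≤ᵇ suc b then h j else 0) N) ≡
  sum (applyUpTo (λ j → if suc j ≤ᵇ b then h j else 0) N) + (if suc b ≤ᵇ N then h b else 0)
sum-applyUpTo-split zero    b       h = refl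
sum-applyUpTo-split (suc N) zero    h = +-comm (h 0) (sum (applyUpTo (λ _ → 0) N))
sum-applyUpTo-split (suc N) (suc b) h =
  trans (cong (_+_ (h 0)) (sum-applyUpTo-split N b (h ∘ suc))) (sym (+-assoc (h 0) _ _))

-- Partitions with bounded parts

-- P(n, m, b), computed by choosing the largest part suc j.
boundedCount : ℕ → ℕ → ℕ → ℕ
boundedCount b zero    zero    = 1
boundedCount b zero    (suc n) = 0
boundedCount b (suc m) zero    = 0
boundedCount b (suc m) (suc n) =
  sum (applyUpTo (λ j → if suc j ≤ᵇ b then boundedCount (suc j) m (n ∸ j) else 0) (suc n))

boundedCount-below : ∀ b {m n} → n < m → boundedCount b m n ≡ 0
boundedCount-below b {suc m} {zero}  _         = refl
boundedCount-below b {suc m} {suc n} (s≤s n<m) = sum-applyUpTo-zero (suc n) λ j →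
  trans (cong (λ x → if suc j ≤ᵇ b then x else 0)
              (boundedCount-below (suc j) (≤-<-trans (m∸n≤m n j) n<m)))
        (if-eta (suc j ≤ᵇ b))

hasLength : ℕ → List ℕ → Bool
hasLength m r = does (length r ≟ m)

partsAtMost : ℕ → List ℕ → Bool
partsAtMost p r = does (all? (λ x → x ≤? p) r)

count-partsLeF-suc : ∀ (g : List ℕ → Bool) f b n →
  count g (partsLeF (suc f) b (suc n)) ≡
  sum (applyUpTo (λ j → if suc j ≤ᵇ b then count (g ∘ (suc j ∷_)) (partsLeF f (suc j) (n ∸ j)) else 0)
                 (suc n))
count-partsLeF-suc g f b n = begin
  count g (concatMap G (filter (λ j → suc j ≤? b) (filter (λ j → suc j ≤? suc n) (upTo (suc n)))))
    ≡⟨ cong (λ js → count g (concatMap G (filter (λ j → suc j ≤? b) js)))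
            (filter-all (λ j → suc j ≤? suc n) (applyUpTo⁺₁ (λ j → j) (suc n) (λ j<n → j<n))) ⟩
  count g (concatMap G (filter (λ j → suc j ≤? b) (upTo (suc n))))
    ≡⟨ count-concatMap g G (filter (λ j → suc j ≤? b) (upTo (suc n))) ⟩
  sum (map (count g ∘ G) (filter (λ j → suc j ≤? b) (upTo (suc n))))
    ≡⟨ sum-map-filter (λ j → suc j ≤? b) (count g ∘ G) (upTo (suc n)) ⟩
  sum (map (λ j → if suc j ≤ᵇ b then count g (G j) else 0) (upTo (suc n)))
    ≡⟨ cong sum (map-upTo _ (suc n)) ⟩
  sum (applyUpTo (λ j → if suc j ≤ᵇ b then count g (G j) else 0) (suc n))
    ≡⟨ sum-applyUpTo-cong (suc n) (λ j → cong (λ x → if suc j ≤ᵇ b then x else 0)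
                                              (count-map g (suc j ∷_) (partsLeF f (suc j) (n ∸ j)))) ⟩
  sum (applyUpTo (λ j → if suc j ≤ᵇ b then count (g ∘ (suc j ∷_)) (partsLeF f (suc j) (n ∸ j)) else 0)
                 (suc n)) ∎
  where
  G : ℕ → List (List ℕ)
  G j = map (suc j ∷_) (partsLeF f (suc j) (n ∸ j))

count-partsLeF-suc-none : ∀ (g : List ℕ → Bool) f b n → (∀ x r → g (x ∷ r) ≡ false) →
                          count g (partsLeF (suc f) b (suc n)) ≡ 0
count-partsLeF-suc-none g f b n rejects =
  trans (count-partsLeF-suc g f b n) (sum-applyUpTo-zero (suc n) λ j →
    trans (cong (λ x → if suc j ≤ᵇ b then x else 0)
                (trans (count-cong (rejects (suc j)) (partsLeF f (suc j) (n ∸ j)))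
                       (count-false (partsLeF f (suc j) (n ∸ j)))))
          (if-eta (suc j ≤ᵇ b)))

count-partsLeF-exact : ∀ f b m n → n ≤ f → count (hasLength m) (partsLeF f b n) ≡ boundedCount b m n
count-partsLeF-exact f       b zero    zero    _         = refl
count-partsLeF-exact f       b (suc m) zero    _         = refl
count-partsLeF-exact (suc f) b zero    (suc n) _         = count-partsLeF-suc-none _ f b n (λ _ _ → refl)
count-partsLeF-exact (suc f) b (suc m) (suc n) (s≤s n≤f) =
  trans (count-partsLeF-suc (hasLength (suc m)) f b n) (sum-applyUpTo-cong (suc n) λ j →
    cong (λ x → if suc j ≤ᵇ b then x else 0)
         (count-partsLeF-exact f (suc j) m (n ∸ j) (≤-trans (m∸n≤m n j) n≤f)))

≤ᵇ-⊓ : ∀ x b p → (x ≤ᵇ b) ∧ (x ≤ᵇ p) ≡ (x ≤ᵇ b ⊓ p)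
≤ᵇ-⊓ zero          b       p       = refl
≤ᵇ-⊓ (suc x)       zero    p       = refl
≤ᵇ-⊓ (suc x)       (suc b) zero    = ∧-zeroʳ _
≤ᵇ-⊓ (suc zero)    (suc b) (suc p) = refl
≤ᵇ-⊓ (suc (suc x)) (suc b) (suc p) = ≤ᵇ-⊓ (suc x) b p

if-≤-⊓ : ∀ x p (F : ℕ → ℕ) → (if x ≤ᵇ p then F (x ⊓ p) else 0) ≡ (if x ≤ᵇ p then F x else 0)
if-≤-⊓ x p F with x ≤ᵇ p | ≤ᵇ-reflects-≤ x p
... | true  | ofʸ x≤p = cong F (m≤n⇒m⊓n≡m x≤p)
... | false | _       = refl

count-partsLeF-bounded : ∀ f b m n p → n ≤ f →
  count (λ r → hasLength m r ∧ partsAtMost p r) (partsLeF f b n) ≡ boundedCount (b ⊓ p) m n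
count-partsLeF-bounded f       b zero    zero    p _         = refl
count-partsLeF-bounded f       b (suc m) zero    p _         = refl
count-partsLeF-bounded (suc f) b zero    (suc n) p _         = count-partsLeF-suc-none _ f b n (λ _ _ → refl)
count-partsLeF-bounded (suc f) b (suc m) (suc n) p (s≤s n≤f) =
  trans (count-partsLeF-suc (λ r → hasLength (suc m) r ∧ partsAtMost p r) f b n)
        (sum-applyUpTo-cong (suc n) summand)
  where
  R : ℕ → List (List ℕ)
  R j = partsLeF f (suc j) (n ∸ j)
  summand : ∀ j →
    (if suc j ≤ᵇ b then count (λ r → hasLength m r ∧ ((suc j ≤ᵇ p) ∧ partsAtMost p r)) (R j) else 0)
    ≡ (if suc j ≤ᵇ b ⊓ p then boundedCount (suc j) m (n ∸ j) else 0)
  summand j = begin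
    (if suc j ≤ᵇ b then count (λ r → hasLength m r ∧ ((suc j ≤ᵇ p) ∧ partsAtMost p r)) (R j) else 0)
      ≡⟨ cong (λ x → if suc j ≤ᵇ b then x else 0)
              (count-∧-guard (hasLength m) (partsAtMost p) (suc j ≤ᵇ p) (R j)) ⟩
    (if suc j ≤ᵇ b then (if suc j ≤ᵇ p then count (λ r → hasLength m r ∧ partsAtMost p r) (R j) else 0) else 0)
      ≡⟨ cong (λ x → if suc j ≤ᵇ b then (if suc j ≤ᵇ p then x else 0) else 0)
              (count-partsLeF-bounded f (suc j) m (n ∸ j) p (≤-trans (m∸n≤m n j) n≤f)) ⟩
    (if suc j ≤ᵇ b then (if suc j ≤ᵇ p then boundedCount (suc j ⊓ p) m (n ∸ j) else 0) else 0)
      ≡⟨ cong (λ x → if suc j ≤ᵇ b then x else 0) (if-≤-⊓ (suc j) p (λ c → boundedCount c m (n ∸ j))) ⟩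
    (if suc j ≤ᵇ b then (if suc j ≤ᵇ p then boundedCount (suc j) m (n ∸ j) else 0) else 0)
      ≡⟨ if-∧ (suc j ≤ᵇ b) ⟨
    (if (suc j ≤ᵇ b) ∧ (suc j ≤ᵇ p) then boundedCount (suc j) m (n ∸ j) else 0)
      ≡⟨ cong (λ c → if c then boundedCount (suc j) m (n ∸ j) else 0) (≤ᵇ-⊓ (suc j) b p) ⟩
    (if suc j ≤ᵇ b ⊓ p then boundedCount (suc j) m (n ∸ j) else 0) ∎

P≡boundedCount : ∀ n m → P n m ≡ boundedCount n m n
P≡boundedCount n m =
  trans (length-filter≡count (λ λs → length λs ≟ m) (partitions n)) (count-partsLeF-exact n n m n ≤-refl)

P₃≡boundedCount : ∀ n m p → P₃ n m p ≡ boundedCount (n ⊓ p) m n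
P₃≡boundedCount n m p =
  trans (length-filter≡count (λ λs → (length λs ≟ m) ×-dec all? (λ x → x ≤? p) λs) (partitions n))
        (count-partsLeF-bounded n n m n p ≤-refl)

-- Formal power series over ℤ, as coefficient functions

Series : Set
Series = ℕ → ℤ

0ₛ : Series
0ₛ _ = + 0

1ₛ : Series
1ₛ zero    = + 1
1ₛ (suc _) = + 0

infixl 6 _⊕_ _⊖_
infixl 7 _⋆_
infixl 8 _·[1-x^_]

_⊕_ : Series → Series → Series
(f ⊕ g) n = f n +ℤ g n

_⊖_ : Series → Series → Series
(f ⊖ g) n = f n -ℤ g n

_⋆_ : Series → Series → Series
(f ⋆ g) n = sumBelow (suc n) (λ k → f k * g (n ∸ k))

shift : ℕ → Series → Series
shift zero    f n       = f n
shift (suc e) f zero    = + 0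
shift (suc e) f (suc n) = shift e f n

_·[1-x^_] : Series → ℕ → Series
f ·[1-x^ e ] = f ⊖ shift e f

sumBelow-cong : ∀ N {f g : Series} → f ≗ g → sumBelow N f ≡ sumBelow N g
sumBelow-cong zero    eq = refl
sumBelow-cong (suc N) eq = cong₂ _+ℤ_ (sumBelow-cong N eq) (eq N)

sumBelow-0ₛ : ∀ N → sumBelow N 0ₛ ≡ + 0
sumBelow-0ₛ zero    = refl
sumBelow-0ₛ (suc N) = trans (ℤ.+-identityʳ (sumBelow N 0ₛ)) (sumBelow-0ₛ N)

sumBelow-⊕ : ∀ N (f g : Series) → sumBelow N (f ⊕ g) ≡ sumBelow N f +ℤ sumBelow N g
sumBelow-⊕ zero    f g = refl
sumBelow-⊕ (suc N) f g =
  trans (cong (_+ℤ (f N +ℤ g N)) (sumBelow-⊕ N f g)) (interchange (sumBelow N f) (sumBelow N g) (f N) (g N))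
  where
  interchange : ∀ a b c d → (a +ℤ b) +ℤ (c +ℤ d) ≡ (a +ℤ c) +ℤ (b +ℤ d)
  interchange = solve-∀

sumBelow-⊖ : ∀ N (f g : Series) → sumBelow N (f ⊖ g) ≡ sumBelow N f -ℤ sumBelow N g
sumBelow-⊖ zero    f g = refl
sumBelow-⊖ (suc N) f g =
  trans (cong (_+ℤ (f N -ℤ g N)) (sumBelow-⊖ N f g)) (interchange (sumBelow N f) (sumBelow N g) (f N) (g N))
  where
  interchange : ∀ a b c d → (a -ℤ b) +ℤ (c -ℤ d) ≡ (a +ℤ c) -ℤ (b +ℤ d)
  interchange = solve-∀

sumBelow-head : ∀ N (f : Series) → sumBelow (suc N) f ≡ f 0 +ℤ sumBelow N (f ∘ suc)
sumBelow-head zero    f = ℤ.+-comm (+ 0) (f 0)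
sumBelow-head (suc N) f =
  trans (cong (_+ℤ f (suc N)) (sumBelow-head N f)) (ℤ.+-assoc (f 0) (sumBelow N (f ∘ suc)) (f (suc N)))

sumBelow-vanishing : ∀ {M N} (f : Series) → M ≤ N → (∀ k → M ≤ k → k < N → f k ≡ + 0) →
                     sumBelow N f ≡ sumBelow M f
sumBelow-vanishing {N = zero}  f z≤n   vanish = refl
sumBelow-vanishing {M} {suc N} f M≤1+N vanish with m≤n⇒m<n∨m≡n M≤1+N
... | inj₂ refl      = refl
... | inj₁ (s≤s M≤N) =
  trans (cong₂ _+ℤ_ (sumBelow-vanishing f M≤N (λ k M≤k k<N → vanish k M≤k (m<n⇒m<1+n k<N)))
                    (vanish N M≤N ≤-refl))
        (ℤ.+-identityʳ (sumBelow M f))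

shift-cong-at : ∀ e n {f g : Series} → f (n ∸ e) ≡ g (n ∸ e) → shift e f n ≡ shift e g n
shift-cong-at zero    n       eq = eq
shift-cong-at (suc e) zero    eq = refl
shift-cong-at (suc e) (suc n) eq = shift-cong-at e n eq

shift-cong : ∀ e {f g : Series} → f ≗ g → shift e f ≗ shift e g
shift-cong e eq n = shift-cong-at e n (eq (n ∸ e))

shift-0ₛ : ∀ e → shift e 0ₛ ≗ 0ₛ
shift-0ₛ zero    n       = refl
shift-0ₛ (suc e) zero    = refl
shift-0ₛ (suc e) (suc n) = shift-0ₛ e n

shift-below : ∀ e (f : Series) {n} → n < e → shift e f n ≡ + 0
shift-below (suc e) f {zero}  _         = refl
shift-below (suc e) f {suc n} (s≤s n<e) = shift-below e f n<e

shift-ℕ : ∀ e n (h : ℕ → ℕ) → shift e (λ k → + h k) n ≡ + (if e ≤ᵇ n then h (n ∸ e) else 0)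
shift-ℕ zero          n       h = refl
shift-ℕ (suc e)       zero    h = refl
shift-ℕ (suc zero)    (suc n) h = refl
shift-ℕ (suc (suc e)) (suc n) h = shift-ℕ (suc e) n h

shift-⊕ : ∀ e (f g : Series) → shift e (f ⊕ g) ≗ shift e f ⊕ shift e g
shift-⊕ zero    f g n       = refl
shift-⊕ (suc e) f g zero    = refl
shift-⊕ (suc e) f g (suc n) = shift-⊕ e f g n

shift-⊖ : ∀ e (f g : Series) → shift e (f ⊖ g) ≗ shift e f ⊖ shift e g
shift-⊖ zero    f g n       = refl
shift-⊖ (suc e) f g zero    = refl
shift-⊖ (suc e) f g (suc n) = shift-⊖ e f g n

shift-shift : ∀ a b (f : Series) → shift a (shift b f) ≗ shift (a + b) f
shift-shift zero    b f n       = refl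
shift-shift (suc a) b f zero    = refl
shift-shift (suc a) b f (suc n) = shift-shift a b f n

shift-regroup : ∀ a b c d → a + b ≡ c + d → (f : Series) → shift a (shift b f) ≗ shift c (shift d f)
shift-regroup a b c d eq f n = begin
  shift a (shift b f) n ≡⟨ shift-shift a b f n ⟩
  shift (a + b) f n     ≡⟨ cong (λ e → shift e f n) eq ⟩
  shift (c + d) f n     ≡⟨ shift-shift c d f n ⟨
  shift c (shift d f) n ∎

shift-comm : ∀ a b (f : Series) → shift a (shift b f) ≗ shift b (shift a f)
shift-comm a b = shift-regroup a b b a (+-comm a b)

·[1-x^]-cong : ∀ e {f g : Series} → f ≗ g → f ·[1-x^ e ] ≗ g ·[1-x^ e ]
·[1-x^]-cong e eq n = cong₂ _-ℤ_ (eq n) (shift-cong e eq n)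

·[1-x^]-comm : ∀ a b (f : Series) → f ·[1-x^ a ] ·[1-x^ b ] ≗ f ·[1-x^ b ] ·[1-x^ a ]
·[1-x^]-comm a b f n = begin
  (f n -ℤ shift a f n) -ℤ shift b (f ⊖ shift a f) n
    ≡⟨ cong ((f n -ℤ shift a f n) -ℤ_) (shift-⊖ b f (shift a f) n) ⟩
  (f n -ℤ shift a f n) -ℤ (shift b f n -ℤ shift b (shift a f) n)
    ≡⟨ cong (λ x → (f n -ℤ shift a f n) -ℤ (shift b f n -ℤ x)) (shift-comm b a f n) ⟩
  (f n -ℤ shift a f n) -ℤ (shift b f n -ℤ shift a (shift b f) n)
    ≡⟨ swap (f n) (shift a f n) (shift b f n) (shift a (shift b f) n) ⟩
  (f n -ℤ shift b f n) -ℤ (shift a f n -ℤ shift a (shift b f) n)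
    ≡⟨ cong ((f n -ℤ shift b f n) -ℤ_) (shift-⊖ a f (shift b f) n) ⟨
  (f n -ℤ shift b f n) -ℤ shift a (f ⊖ shift b f) n ∎
  where
  swap : ∀ w x y z → (w -ℤ x) -ℤ (y -ℤ z) ≡ (w -ℤ y) -ℤ (x -ℤ z)
  swap = solve-∀

·[1-x^]-+ : ∀ a b (f : Series) → f ·[1-x^ a + b ] ≗ f ·[1-x^ a ] ⊕ shift a (f ·[1-x^ b ])
·[1-x^]-+ a b f n = begin
  f n -ℤ shift (a + b) f n
    ≡⟨ cong (f n -ℤ_) (shift-shift a b f n) ⟨
  f n -ℤ shift a (shift b f) n
    ≡⟨ telescope (f n) (shift a f n) (shift a (shift b f) n) ⟩
  (f n -ℤ shift a f n) +ℤ (shift a f n -ℤ shift a (shift b f) n)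
    ≡⟨ cong ((f n -ℤ shift a f n) +ℤ_) (shift-⊖ a f (shift b f) n) ⟨
  (f n -ℤ shift a f n) +ℤ shift a (f ⊖ shift b f) n ∎
  where
  telescope : ∀ x y z → x -ℤ z ≡ (x -ℤ y) +ℤ (y -ℤ z)
  telescope = solve-∀

⋆-congˡ : ∀ (g : Series) {f f′ : Series} → f ≗ f′ → f ⋆ g ≗ f′ ⋆ g
⋆-congˡ g eq n = sumBelow-cong (suc n) (λ k → cong (_* g (n ∸ k)) (eq k))

⋆-congʳ : ∀ (f : Series) {g g′ : Series} → g ≗ g′ → f ⋆ g ≗ f ⋆ g′
⋆-congʳ f eq n = sumBelow-cong (suc n) (λ k → cong (f k *_) (eq (n ∸ k)))

⋆-head : ∀ (f g : Series) n → (f ⋆ g) n ≡ f 0 * g n +ℤ shift 1 ((f ∘ suc) ⋆ g) n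
⋆-head f g zero    = ℤ.+-comm (+ 0) (f 0 * g 0)
⋆-head f g (suc n) = sumBelow-head (suc n) (λ k → f k * g (suc n ∸ k))

-- Splitting off the constant terms of both factors reduces commutativity at suc n to
-- commutativity at n and at n ∸ 1.
⋆-comm : ∀ (f g : Series) → f ⋆ g ≗ g ⋆ f
⋆-comm f g zero    = cong (+ 0 +ℤ_) (ℤ.*-comm (f 0) (g 0))
⋆-comm f g (suc n) = begin
  (f ⋆ g) (suc n)
    ≡⟨ expand f g ⟩
  f 0 * g (suc n) +ℤ (g 0 * f (suc n) +ℤ shift 1 (g′ ⋆ f′) n)
    ≡⟨ cong (λ x → f 0 * g (suc n) +ℤ (g 0 * f (suc n) +ℤ x)) (tails n) ⟩
  f 0 * g (suc n) +ℤ (g 0 * f (suc n) +ℤ shift 1 (f′ ⋆ g′) n)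
    ≡⟨ left-comm (f 0 * g (suc n)) (g 0 * f (suc n)) (shift 1 (f′ ⋆ g′) n) ⟩
  g 0 * f (suc n) +ℤ (f 0 * g (suc n) +ℤ shift 1 (f′ ⋆ g′) n)
    ≡⟨ expand g f ⟨
  (g ⋆ f) (suc n) ∎
  where
  f′ g′ : Series
  f′ = f ∘ suc
  g′ = g ∘ suc
  expand : ∀ (u v : Series) →
           (u ⋆ v) (suc n) ≡ u 0 * v (suc n) +ℤ (v 0 * u (suc n) +ℤ shift 1 ((v ∘ suc) ⋆ (u ∘ suc)) n)
  expand u v = trans (sumBelow-head (suc n) (λ k → u k * v (suc n ∸ k)))
                     (cong (u 0 * v (suc n) +ℤ_) (trans (⋆-comm (u ∘ suc) v n) (⋆-head v (u ∘ suc) n)))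
  tails : ∀ m → shift 1 (g′ ⋆ f′) m ≡ shift 1 (f′ ⋆ g′) m
  tails zero    = refl
  tails (suc m) = ⋆-comm g′ f′ m
  left-comm : ∀ x y z → x +ℤ (y +ℤ z) ≡ y +ℤ (x +ℤ z)
  left-comm = solve-∀

⋆-zeroˡ : ∀ (g : Series) → 0ₛ ⋆ g ≗ 0ₛ
⋆-zeroˡ g n = sumBelow-0ₛ (suc n)

⋆-identityˡ : ∀ (g : Series) → 1ₛ ⋆ g ≗ g
⋆-identityˡ g n = begin
  (1ₛ ⋆ g) n
    ≡⟨ ⋆-head 1ₛ g n ⟩
  + 1 * g n +ℤ shift 1 (0ₛ ⋆ g) n
    ≡⟨ cong₂ _+ℤ_ (ℤ.*-identityˡ (g n)) (trans (shift-cong 1 (⋆-zeroˡ g) n) (shift-0ₛ 1 n)) ⟩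
  g n +ℤ + 0
    ≡⟨ ℤ.+-identityʳ (g n) ⟩
  g n ∎

⋆-shiftˡ : ∀ e (f g : Series) → shift e f ⋆ g ≗ shift e (f ⋆ g)
⋆-shiftˡ zero    f g n = refl
⋆-shiftˡ (suc e) f g n = begin
  (shift (suc e) f ⋆ g) n          ≡⟨ ⋆-head (shift (suc e) f) g n ⟩
  + 0 +ℤ shift 1 (shift e f ⋆ g) n ≡⟨ ℤ.+-identityˡ (shift 1 (shift e f ⋆ g) n) ⟩
  shift 1 (shift e f ⋆ g) n        ≡⟨ shift-cong 1 (⋆-shiftˡ e f g) n ⟩
  shift 1 (shift e (f ⋆ g)) n      ≡⟨ shift-shift 1 e (f ⋆ g) n ⟩
  shift (suc e) (f ⋆ g) n          ∎

⋆-shiftʳ : ∀ e (f g : Series) → f ⋆ shift e g ≗ shift e (f ⋆ g)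
⋆-shiftʳ e f g n = begin
  (f ⋆ shift e g) n   ≡⟨ ⋆-comm f (shift e g) n ⟩
  (shift e g ⋆ f) n   ≡⟨ ⋆-shiftˡ e g f n ⟩
  shift e (g ⋆ f) n   ≡⟨ shift-cong e (⋆-comm g f) n ⟩
  shift e (f ⋆ g) n   ∎

⋆-⊕ˡ : ∀ (f g h : Series) → (f ⊕ g) ⋆ h ≗ f ⋆ h ⊕ g ⋆ h
⋆-⊕ˡ f g h n = trans (sumBelow-cong (suc n) (λ k → ℤ.*-distribʳ-+ (h (n ∸ k)) (f k) (g k)))
                     (sumBelow-⊕ (suc n) (λ k → f k * h (n ∸ k)) (λ k → g k * h (n ∸ k)))

⋆-⊖ˡ : ∀ (f g h : Series) → (f ⊖ g) ⋆ h ≗ f ⋆ h ⊖ g ⋆ h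
⋆-⊖ˡ f g h n = trans (sumBelow-cong (suc n) (λ k → distrib (f k) (g k) (h (n ∸ k))))
                     (sumBelow-⊖ (suc n) (λ k → f k * h (n ∸ k)) (λ k → g k * h (n ∸ k)))
  where
  distrib : ∀ x y z → (x -ℤ y) * z ≡ x * z -ℤ y * z
  distrib = solve-∀

·[1-x^]-⋆ˡ : ∀ e (f g : Series) → f ·[1-x^ e ] ⋆ g ≗ (f ⋆ g) ·[1-x^ e ]
·[1-x^]-⋆ˡ e f g n = trans (⋆-⊖ˡ f (shift e f) g n) (cong ((f ⋆ g) n -ℤ_) (⋆-shiftˡ e f g n))

·[1-x^]-⋆ʳ : ∀ e (f g : Series) → f ⋆ g ·[1-x^ e ] ≗ (f ⋆ g) ·[1-x^ e ]
·[1-x^]-⋆ʳ e f g n = begin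
  (f ⋆ g ·[1-x^ e ]) n    ≡⟨ ⋆-comm f (g ·[1-x^ e ]) n ⟩
  (g ·[1-x^ e ] ⋆ f) n    ≡⟨ ·[1-x^]-⋆ˡ e g f n ⟩
  ((g ⋆ f) ·[1-x^ e ]) n  ≡⟨ ·[1-x^]-cong e (⋆-comm g f) n ⟩
  ((f ⋆ g) ·[1-x^ e ]) n  ∎

-- Coefficients of the polynomials ∏ (1 - q ^ (p + j))

coeff-addP : ∀ xs ys → coeff (addP xs ys) ≗ coeff xs ⊕ coeff ys
coeff-addP []       ys       n       = sym (ℤ.+-identityˡ (coeff ys n))
coeff-addP (x ∷ xs) []       n       = sym (ℤ.+-identityʳ (coeff (x ∷ xs) n))
coeff-addP (x ∷ xs) (y ∷ ys) zero    = refl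
coeff-addP (x ∷ xs) (y ∷ ys) (suc n) = coeff-addP xs ys n

coeff-scaleP : ∀ c xs n → coeff (scaleP c xs) n ≡ c * coeff xs n
coeff-scaleP c []       n       = sym (ℤ.*-zeroʳ c)
coeff-scaleP c (x ∷ xs) zero    = refl
coeff-scaleP c (x ∷ xs) (suc n) = coeff-scaleP c xs n

coeff-0∷ : ∀ xs → coeff (+ 0 ∷ xs) ≗ shift 1 (coeff xs)
coeff-0∷ xs zero    = refl
coeff-0∷ xs (suc n) = refl

coeff-1 : coeff (+ 1 ∷ []) ≗ 1ₛ
coeff-1 zero    = refl
coeff-1 (suc n) = refl

coeff-monoP : ∀ e → coeff (monoP e) ≗ shift e 1ₛ
coeff-monoP zero    n       = coeff-1 n
coeff-monoP (suc e) zero    = refl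
coeff-monoP (suc e) (suc n) = coeff-monoP e n

coeff-oneMinusQ^ : ∀ e → coeff (oneMinusQ^ e) ≗ 1ₛ ·[1-x^ e ]
coeff-oneMinusQ^ e n = begin
  coeff (addP (+ 1 ∷ []) (scaleP (- + 1) (monoP e))) n
    ≡⟨ coeff-addP (+ 1 ∷ []) (scaleP (- + 1) (monoP e)) n ⟩
  coeff (+ 1 ∷ []) n +ℤ coeff (scaleP (- + 1) (monoP e)) n
    ≡⟨ cong₂ _+ℤ_ (coeff-1 n) (trans (coeff-scaleP (- + 1) (monoP e) n) (cong (- + 1 *_) (coeff-monoP e n))) ⟩
  1ₛ n +ℤ - + 1 * shift e 1ₛ n
    ≡⟨ minus-one (1ₛ n) (shift e 1ₛ n) ⟩
  1ₛ n -ℤ shift e 1ₛ n ∎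
  where
  minus-one : ∀ x y → x +ℤ - + 1 * y ≡ x -ℤ y
  minus-one = solve-∀

coeff-mulP : ∀ xs ys → coeff (mulP xs ys) ≗ coeff xs ⋆ coeff ys
coeff-mulP []       ys n = sym (⋆-zeroˡ (coeff ys) n)
coeff-mulP (x ∷ xs) ys n = begin
  coeff (addP (scaleP x ys) (+ 0 ∷ mulP xs ys)) n
    ≡⟨ coeff-addP (scaleP x ys) (+ 0 ∷ mulP xs ys) n ⟩
  coeff (scaleP x ys) n +ℤ coeff (+ 0 ∷ mulP xs ys) n
    ≡⟨ cong₂ _+ℤ_ (coeff-scaleP x ys n)
                  (trans (coeff-0∷ (mulP xs ys) n) (shift-cong 1 (coeff-mulP xs ys) n)) ⟩
  x * coeff ys n +ℤ shift 1 (coeff xs ⋆ coeff ys) n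
    ≡⟨ ⋆-head (coeff (x ∷ xs)) (coeff ys) n ⟨
  (coeff (x ∷ xs) ⋆ coeff ys) n ∎

A : ℕ → ℕ → Series
A m p = coeff (prodPoly m p)

A-zero : ∀ p → A 0 p ≗ 1ₛ
A-zero p = coeff-1

A-suc : ∀ m p → A (suc m) p ≗ A m p ·[1-x^ p + suc m ]
A-suc m p n = begin
  coeff (mulP (prodPoly m p) (oneMinusQ^ e)) n ≡⟨ coeff-mulP (prodPoly m p) (oneMinusQ^ e) n ⟩
  (A m p ⋆ coeff (oneMinusQ^ e)) n             ≡⟨ ⋆-comm (A m p) (coeff (oneMinusQ^ e)) n ⟩
  (coeff (oneMinusQ^ e) ⋆ A m p) n             ≡⟨ ⋆-congˡ (A m p) (coeff-oneMinusQ^ e) n ⟩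
  (1ₛ ·[1-x^ e ] ⋆ A m p) n                    ≡⟨ ·[1-x^]-⋆ˡ e 1ₛ (A m p) n ⟩
  ((1ₛ ⋆ A m p) ·[1-x^ e ]) n                  ≡⟨ ·[1-x^]-cong e (⋆-identityˡ (A m p)) n ⟩
  (A m p ·[1-x^ e ]) n                         ∎
  where
  e = p + suc m

A-suc-first : ∀ m p → A (suc m) p ≗ A m (suc p) ·[1-x^ suc p ]
A-suc-first zero    p n = trans (A-suc zero p n) (cong (λ e → (A 0 p ·[1-x^ e ]) n) (+-comm p 1))
A-suc-first (suc m) p n = begin
  A (suc (suc m)) p n                         ≡⟨ A-suc (suc m) p n ⟩
  (A (suc m) p ·[1-x^ e ]) n                  ≡⟨ ·[1-x^]-cong e (A-suc-first m p) n ⟩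
  (B ·[1-x^ suc p ] ·[1-x^ e ]) n             ≡⟨ ·[1-x^]-comm (suc p) e B n ⟩
  (B ·[1-x^ e ] ·[1-x^ suc p ]) n             ≡⟨ cong (λ d → (B ·[1-x^ d ] ·[1-x^ suc p ]) n) (+-suc p (suc m)) ⟩
  (B ·[1-x^ suc p + suc m ] ·[1-x^ suc p ]) n ≡⟨ ·[1-x^]-cong (suc p) (A-suc m (suc p)) n ⟨
  (A (suc m) (suc p) ·[1-x^ suc p ]) n        ∎
  where
  B = A m (suc p)
  e = p + suc (suc m)

A-suc-suc : ∀ m c → A (suc m) (suc c) ≗ A (suc m) c ⊕ shift (suc c) (A m (suc c) ·[1-x^ suc m ])
A-suc-suc m c n = begin
  A (suc m) (suc c) n                   ≡⟨ A-suc m (suc c) n ⟩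
  (B ·[1-x^ suc c + suc m ]) n          ≡⟨ ·[1-x^]-+ (suc c) (suc m) B n ⟩
  (B ·[1-x^ suc c ]) n +ℤ S n           ≡⟨ cong (_+ℤ S n) (A-suc-first m c n) ⟨
  A (suc m) c n +ℤ S n                  ∎
  where
  B = A m (suc c)
  S = shift (suc c) (B ·[1-x^ suc m ])

-- Generating series of partitions

bounded : ℕ → ℕ → Series
bounded b m n = + boundedCount b m n

exact : ℕ → Series
exact m n = + P n m

bounded-zero : ∀ b → bounded b 0 ≗ 1ₛ
bounded-zero b zero    = refl
bounded-zero b (suc n) = refl

bounded-0-suc : ∀ m → bounded 0 (suc m) ≗ 0ₛ
bounded-0-suc m zero    = refl
bounded-0-suc m (suc n) = cong +_ (sum-applyUpTo-zero (suc n) (λ _ → refl))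

bounded-largest : ∀ b m → bounded (suc b) (suc m) ≗ bounded b (suc m) ⊕ shift (suc b) (bounded (suc b) m)
bounded-largest b m zero    = refl
bounded-largest b m (suc n) = begin
  + sum (applyUpTo (λ j → if suc j ≤ᵇ suc b then h j else 0) (suc n))
    ≡⟨ cong +_ (sum-applyUpTo-split (suc n) b h) ⟩
  + (boundedCount b (suc m) (suc n) + (if suc b ≤ᵇ suc n then h b else 0))
    ≡⟨ ℤ.pos-+ (boundedCount b (suc m) (suc n)) _ ⟩
  bounded b (suc m) (suc n) +ℤ + (if suc b ≤ᵇ suc n then h b else 0)
    ≡⟨ cong (bounded b (suc m) (suc n) +ℤ_) (shift-ℕ (suc b) (suc n) (boundedCount (suc b) m)) ⟨
  bounded b (suc m) (suc n) +ℤ shift (suc b) (bounded (suc b) m) (suc n) ∎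
  where
  h : ℕ → ℕ
  h j = boundedCount (suc j) m (n ∸ j)

bounded-suc : ∀ {b n} m → n ≤ b → bounded (suc b) m n ≡ bounded b m n
bounded-suc {b} {n} zero    _   = trans (bounded-zero (suc b) n) (sym (bounded-zero b n))
bounded-suc {b} {n} (suc m) n≤b = begin
  bounded (suc b) (suc m) n  ≡⟨ bounded-largest b m n ⟩
  Y +ℤ shift (suc b) X n     ≡⟨ cong (Y +ℤ_) (shift-below (suc b) X (s≤s n≤b)) ⟩
  Y +ℤ + 0                   ≡⟨ ℤ.+-identityʳ Y ⟩
  Y                          ∎
  where
  X = bounded (suc b) m
  Y = bounded b (suc m) n

bounded-stable : ∀ {b n} m → n ≤ b → bounded b m n ≡ exact m n
bounded-stable {b} {n} m n≤b = begin
  bounded b m n           ≡⟨ cong (λ c → bounded c m n) (m∸n+n≡m n≤b) ⟨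
  bounded (b ∸ n + n) m n ≡⟨ lower (b ∸ n) ⟩
  bounded n m n           ≡⟨ cong +_ (P≡boundedCount n m) ⟨
  exact m n               ∎
  where
  lower : ∀ d → bounded (d + n) m n ≡ bounded n m n
  lower zero    = refl
  lower (suc d) = trans (bounded-suc m (m≤n+m n d)) (lower d)

bounded-⊓ : ∀ b m n → bounded (n ⊓ b) m n ≡ bounded b m n
bounded-⊓ b m n with ≤-total b n
... | inj₁ b≤n = cong (λ c → bounded c m n) (m≥n⇒m⊓n≡n b≤n)
... | inj₂ n≤b = trans (bounded-stable m (≤-reflexive (sym (m≤n⇒m⊓n≡m n≤b))))
                       (sym (bounded-stable m n≤b))

exact-zero : exact 0 ≗ 1ₛ
exact-zero n = trans (sym (bounded-stable {n} 0 ≤-refl)) (bounded-zero n n)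

exact-below : ∀ {m n} → n < m → exact m n ≡ + 0
exact-below {m} {n} n<m = cong +_ (trans (P≡boundedCount n m) (boundedCount-below n n<m))

bounded-one : ∀ m → bounded 1 (suc m) ≗ shift 1 (bounded 1 m)
bounded-one m n = begin
  bounded 1 (suc m) n                            ≡⟨ bounded-largest 0 m n ⟩
  bounded 0 (suc m) n +ℤ shift 1 (bounded 1 m) n ≡⟨ cong (_+ℤ shift 1 (bounded 1 m) n) (bounded-0-suc m n) ⟩
  + 0 +ℤ shift 1 (bounded 1 m) n                 ≡⟨ ℤ.+-identityˡ (shift 1 (bounded 1 m) n) ⟩
  shift 1 (bounded 1 m) n                        ∎

bounded-smallest : ∀ b m →
  bounded (suc b) (suc m) ≗ shift 1 (bounded (suc b) m) ⊕ shift (suc m) (bounded b (suc m))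
bounded-smallest zero m n = begin
  bounded 1 (suc m) n                    ≡⟨ bounded-one m n ⟩
  S                                      ≡⟨ ℤ.+-identityʳ S ⟨
  S +ℤ + 0                               ≡⟨ cong (S +ℤ_) vanishing ⟨
  S +ℤ shift (suc m) (bounded 0 (suc m)) n ∎
  where
  S = shift 1 (bounded 1 m) n
  vanishing : shift (suc m) (bounded 0 (suc m)) n ≡ + 0
  vanishing = trans (shift-cong (suc m) (bounded-0-suc m) n) (shift-0ₛ (suc m) n)
bounded-smallest (suc b) zero n = begin
  bounded (2 + b) 1 n
    ≡⟨ bounded-largest (suc b) 0 n ⟩
  bounded (suc b) 1 n +ℤ shift (2 + b) (bounded (2 + b) 0) n
    ≡⟨ cong₂ _+ℤ_ (bounded-smallest b zero n) (shift-cong (2 + b) (bounded-zero (2 + b)) n) ⟩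
  (shift 1 (bounded (suc b) 0) n +ℤ V) +ℤ shift (2 + b) 1ₛ n
    ≡⟨ cong (λ x → (x +ℤ V) +ℤ shift (2 + b) 1ₛ n) (shift-cong 1 (bounded-zero (suc b)) n) ⟩
  (shift 1 1ₛ n +ℤ V) +ℤ shift (2 + b) 1ₛ n
    ≡⟨ ℤ.+-assoc (shift 1 1ₛ n) V (shift (2 + b) 1ₛ n) ⟩
  shift 1 1ₛ n +ℤ (V +ℤ shift (2 + b) 1ₛ n)
    ≡⟨ cong (λ x → shift 1 1ₛ n +ℤ (V +ℤ x)) (shift-shift 1 (suc b) 1ₛ n) ⟨
  shift 1 1ₛ n +ℤ (V +ℤ shift 1 (shift (suc b) 1ₛ) n)
    ≡⟨ cong (shift 1 1ₛ n +ℤ_) (shift-⊕ 1 (bounded b 1) (shift (suc b) 1ₛ) n) ⟨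
  shift 1 1ₛ n +ℤ shift 1 (bounded b 1 ⊕ shift (suc b) 1ₛ) n
    ≡⟨ cong₂ _+ℤ_ (shift-cong 1 (bounded-zero (2 + b)) n) (shift-cong 1 largest n) ⟨
  shift 1 (bounded (2 + b) 0) n +ℤ shift 1 (bounded (suc b) 1) n ∎
  where
  V = shift 1 (bounded b 1) n
  largest : bounded (suc b) 1 ≗ bounded b 1 ⊕ shift (suc b) 1ₛ
  largest k = trans (bounded-largest b 0 k)
                    (cong (bounded b 1 k +ℤ_) (shift-cong (suc b) (bounded-zero (suc b)) k))
bounded-smallest (suc b) (suc m) n = begin
  bounded (2 + b) (2 + m) n
    ≡⟨ bounded-largest (suc b) (suc m) n ⟩
  bounded (suc b) (2 + m) n +ℤ shift (2 + b) (bounded (2 + b) (suc m)) n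
    ≡⟨ cong₂ _+ℤ_ (bounded-smallest b (suc m) n)
                  (trans (shift-cong (2 + b) (bounded-smallest (suc b) m) n)
                         (shift-⊕ (2 + b) (shift 1 X) (shift (suc m) Y) n)) ⟩
  (shift 1 Y n +ℤ shift (2 + m) Z n) +ℤ (shift (2 + b) (shift 1 X) n +ℤ shift (2 + b) (shift (suc m) Y) n)
    ≡⟨ interchange (shift 1 Y n) (shift (2 + m) Z n) (shift (2 + b) (shift 1 X) n) _ ⟩
  (shift 1 Y n +ℤ shift (2 + b) (shift 1 X) n) +ℤ (shift (2 + m) Z n +ℤ shift (2 + b) (shift (suc m) Y) n)
    ≡⟨ cong₂ (λ x y → (shift 1 Y n +ℤ x) +ℤ (shift (2 + m) Z n +ℤ y))
             (shift-regroup (2 + b) 1 1 (2 + b) (+-comm (2 + b) 1) X n)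
             (shift-regroup (2 + b) (suc m) (2 + m) (suc b) (cong suc (+-comm (suc b) (suc m))) Y n) ⟩
  (shift 1 Y n +ℤ shift 1 (shift (2 + b) X) n) +ℤ (shift (2 + m) Z n +ℤ shift (2 + m) (shift (suc b) Y) n)
    ≡⟨ cong₂ _+ℤ_ (shift-⊕ 1 Y (shift (2 + b) X) n) (shift-⊕ (2 + m) Z (shift (suc b) Y) n) ⟨
  shift 1 (Y ⊕ shift (2 + b) X) n +ℤ shift (2 + m) (Z ⊕ shift (suc b) Y) n
    ≡⟨ cong₂ _+ℤ_ (shift-cong 1 (bounded-largest (suc b) m) n)
                  (shift-cong (2 + m) (bounded-largest b (suc m)) n) ⟨
  shift 1 (bounded (2 + b) (suc m)) n +ℤ shift (2 + m) (bounded (suc b) (2 + m)) n ∎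
  where
  X = bounded (2 + b) m
  Y = bounded (suc b) (suc m)
  Z = bounded b (2 + m)
  interchange : ∀ w x y z → (w +ℤ x) +ℤ (y +ℤ z) ≡ (w +ℤ y) +ℤ (x +ℤ z)
  interchange = solve-∀

exact-·[1-x^] : ∀ m → exact (suc m) ·[1-x^ suc m ] ≗ shift 1 (exact m)
exact-·[1-x^] m n = begin
  exact (suc m) n -ℤ E
    ≡⟨ cong (_-ℤ E) (trans (sym (bounded-stable (suc m) (n≤1+n n))) (bounded-smallest n m n)) ⟩
  (shift 1 (bounded (suc n) m) n +ℤ shift (suc m) (bounded n (suc m)) n) -ℤ E
    ≡⟨ cong₂ (λ x y → (x +ℤ y) -ℤ E)
             (shift-cong-at 1 n (bounded-stable m (≤-trans (m∸n≤m n 1) (n≤1+n n))))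
             (shift-cong-at (suc m) n (bounded-stable (suc m) (m∸n≤m n (suc m)))) ⟩
  (shift 1 (exact m) n +ℤ E) -ℤ E
    ≡⟨ cancel (shift 1 (exact m) n) E ⟩
  shift 1 (exact m) n ∎
  where
  E = shift (suc m) (exact (suc m)) n
  cancel : ∀ x y → (x +ℤ y) -ℤ y ≡ x
  cancel = solve-∀

⋆-exact-·[1-x^] : ∀ m (f : Series) → f ·[1-x^ suc m ] ⋆ exact (suc m) ≗ shift 1 (f ⋆ exact m)
⋆-exact-·[1-x^] m f n = begin
  (f ·[1-x^ suc m ] ⋆ exact (suc m)) n   ≡⟨ ·[1-x^]-⋆ˡ (suc m) f (exact (suc m)) n ⟩
  ((f ⋆ exact (suc m)) ·[1-x^ suc m ]) n ≡⟨ ·[1-x^]-⋆ʳ (suc m) f (exact (suc m)) n ⟨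
  (f ⋆ exact (suc m) ·[1-x^ suc m ]) n   ≡⟨ ⋆-congʳ f (exact-·[1-x^] m) n ⟩
  (f ⋆ shift 1 (exact m)) n              ≡⟨ ⋆-shiftʳ 1 f (exact m) n ⟩
  shift 1 (f ⋆ exact m) n                ∎

bounded≗A⋆exact : ∀ c m → bounded (suc c) m ≗ A m c ⋆ exact m
bounded≗A⋆exact c zero n = begin
  bounded (suc c) 0 n    ≡⟨ bounded-zero (suc c) n ⟩
  1ₛ n                   ≡⟨ exact-zero n ⟨
  exact 0 n              ≡⟨ ⋆-identityˡ (exact 0) n ⟨
  (1ₛ ⋆ exact 0) n       ≡⟨ ⋆-congˡ (exact 0) (A-zero c) n ⟨
  (A 0 c ⋆ exact 0) n    ∎
bounded≗A⋆exact zero (suc m) n = begin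
  bounded 1 (suc m) n                       ≡⟨ bounded-one m n ⟩
  shift 1 (bounded 1 m) n                   ≡⟨ shift-cong 1 (bounded≗A⋆exact zero m) n ⟩
  shift 1 (A m 0 ⋆ exact m) n               ≡⟨ ⋆-exact-·[1-x^] m (A m 0) n ⟨
  (A m 0 ·[1-x^ suc m ] ⋆ exact (suc m)) n  ≡⟨ ⋆-congˡ (exact (suc m)) (A-suc m 0) n ⟨
  (A (suc m) 0 ⋆ exact (suc m)) n           ∎
bounded≗A⋆exact (suc c) (suc m) n = begin
  bounded (2 + c) (suc m) n
    ≡⟨ bounded-largest (suc c) m n ⟩
  bounded (suc c) (suc m) n +ℤ shift (2 + c) (bounded (2 + c) m) n
    ≡⟨ cong₂ _+ℤ_ (bounded≗A⋆exact c (suc m) n) (shift-cong (2 + c) (bounded≗A⋆exact (suc c) m) n) ⟩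
  H n +ℤ shift (2 + c) F n
    ≡⟨ cong (H n +ℤ_) (trans (shift-comm (suc c) 1 F n) (shift-shift 1 (suc c) F n)) ⟨
  H n +ℤ shift (suc c) (shift 1 F) n
    ≡⟨ cong (H n +ℤ_) (shift-cong (suc c) (⋆-exact-·[1-x^] m B) n) ⟨
  H n +ℤ shift (suc c) (B ·[1-x^ suc m ] ⋆ E) n
    ≡⟨ cong (H n +ℤ_) (⋆-shiftˡ (suc c) (B ·[1-x^ suc m ]) E n) ⟨
  H n +ℤ (shift (suc c) (B ·[1-x^ suc m ]) ⋆ E) n
    ≡⟨ ⋆-⊕ˡ (A (suc m) c) (shift (suc c) (B ·[1-x^ suc m ])) E n ⟨
  ((A (suc m) c ⊕ shift (suc c) (B ·[1-x^ suc m ])) ⋆ E) n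
    ≡⟨ ⋆-congˡ E (A-suc-suc m c) n ⟨
  (A (suc m) (suc c) ⋆ E) n ∎
  where
  B = A m (suc c)
  E = exact (suc m)
  F = B ⋆ exact m
  H = A (suc m) c ⋆ E

⋆-exact-truncated : ∀ (f : Series) m n →
                    (f ⋆ exact m) n ≡ sumBelow (suc n ∸ m) (λ k → f k * exact m (n ∸ k))
⋆-exact-truncated f m n = sumBelow-vanishing _ (m∸n≤m (suc n) m) vanish
  where
  vanish : ∀ k → suc n ∸ m ≤ k → k < suc n → f k * exact m (n ∸ k) ≡ + 0
  vanish k bound (s≤s k≤n) = trans (cong (f k *_) (exact-below n∸k<m)) (ℤ.*-zeroʳ (f k))
    where
    n∸k<m : n ∸ k < m
    n∸k<m = subst (_≤ m) (+-∸-assoc 1 k≤n)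
              (m≤n+o⇒m∸n≤o (suc n) k (≤-trans (m≤n+m∸n (suc n) m)
                                              (≤-trans (+-monoʳ-≤ m bound) (≤-reflexive (+-comm m k)))))

mainTheorem14 : (n m p : ℕ) → 1 ≤ p →
    + P₃ n m p ≡ sumBelow ((n + 1) ∸ m) (λ k → a k m (p ∸ 1) * + P (n ∸ k) m)
mainTheorem14 n m (suc c) _ = begin
  + P₃ n m (suc c)                           ≡⟨ cong +_ (P₃≡boundedCount n m (suc c)) ⟩
  bounded (n ⊓ suc c) m n                    ≡⟨ bounded-⊓ (suc c) m n ⟩
  bounded (suc c) m n                        ≡⟨ bounded≗A⋆exact c m n ⟩
  (A m c ⋆ exact m) n                        ≡⟨ ⋆-exact-truncated (A m c) m n ⟩
  sumBelow (suc n ∸ m) (λ k → a k m c * + P (n ∸ k) m)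
    ≡⟨ cong (λ N → sumBelow (N ∸ m) (λ k → a k m c * + P (n ∸ k) m)) (+-comm 1 n) ⟩
  sumBelow ((n + 1) ∸ m) (λ k → a k m c * + P (n ∸ k) m) ∎
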